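{- Let $A,B$ be commutative monoids, and let $F$ and $G$ be subfunctors of $F_A$ and $F_B$ respectively, with inclusion natural transformations $\iota_A\colon F\Rightarrow F_A$ and $\iota_B\colon G\Rightarrow F_B$. Assume that for every map $g\colon X\to Y$ and every $f\in F_A(X)$, $F_A(g)(f)\in F(Y)$ implies $f\in F(X)$. Then for every natural transformation $\lambda\colon F\Rightarrow G$ there is a natural transformation $\lambda'\colon F_A\Rightarrow F_B$ with $\iota_B\circ\lambda=\lambda'\circ\iota_A$.
   Context: $F_A$ sends $X$ to the finitely supported functions $X\to A$ and $g\colon X\to Y$ to $F_A(g)(f)(y)=\sum_{x\in g^{ -1}(y)}f(x)$; similarly for $F_B$. -}

module Defs where

open import Level using (0ℓ)
open import Data.List using (List; []; _∷_; map)
open import Data.Product using (Σ; _×_; _,_; map₁)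
open import Algebra.Bundles using (CommutativeMonoid)

-- The functor F_A : Set → Set of finitely supported functions X → A,
-- presented as formal finite sums  Σ a_i · x_i  (lists of pairs (x_i , a_i))
-- modulo the equivalence identifying two formal sums that give the same
-- function X → A (the congruence generated by reordering, merging equal
-- points, and dropping zero coefficients).  Elements of F_A(X) are thus
-- the equivalence classes (setoid presentation of the quotient).
module FinSupp (M : CommutativeMonoid 0ℓ 0ℓ) where
  open CommutativeMonoid M

  FS : Set → Set
  FS X = List (X × Carrier)

  infix 4 _∼_
  data _∼_ {X : Set} : FS X → FS X → Set where
    ∼-refl  : ∀ {l} → l ∼ l
    ∼-sym   : ∀ {l l'} → l ∼ l' → l' ∼ l
    ∼-trans : ∀ {l l' l''} → l ∼ l' → l' ∼ l'' → l ∼ l''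
    ∼-cons  : ∀ (x : X) {a b l l'} → a ≈ b → l ∼ l' → ((x , a) ∷ l) ∼ ((x , b) ∷ l')
    ∼-swap  : ∀ p q l → (p ∷ q ∷ l) ∼ (q ∷ p ∷ l)
    ∼-merge : ∀ (x : X) a b l → ((x , a) ∷ (x , b) ∷ l) ∼ ((x , a ∙ b) ∷ l)
    ∼-zero  : ∀ (x : X) l → ((x , ε) ∷ l) ∼ l

  -- F_A(g)(f)(y) = Σ_{x ∈ g⁻¹(y)} f(x): push each coefficient forward along g.
  FSmap : {X Y : Set} → (X → Y) → FS X → FS Y
  FSmap g = map (map₁ g)

  record Subfunctor : Set₁ where
    field
      mem    : (X : Set) → FS X → Set
      mem-∼  : ∀ {X} {f f' : FS X} → f ∼ f' → mem X f → mem X f'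
      mem-map : ∀ {X Y} (g : X → Y) (f : FS X) → mem X f → mem Y (FSmap g f)

-- An element of F(X) is an f : F_A(X) with a membership witness; its
-- identity is that of f (so F(X) really is a subset of F_A(X)).
module _ (A B : CommutativeMonoid 0ℓ 0ℓ) where
  private
    module FA = FinSupp A
    module FB = FinSupp B

  record NatTrans (F : FA.Subfunctor) (G : FB.Subfunctor) : Set₁ where
    private
      module F = FA.Subfunctor F
      module G = FB.Subfunctor G
    field
      η       : (X : Set) (f : FA.FS X) → F.mem X f → FB.FS X
      η-mem   : ∀ X f (p : F.mem X f) → G.mem X (η X f p)
      η-resp  : ∀ {X} {f f' : FA.FS X} (p : F.mem X f) (p' : F.mem X f') →
                f FA.∼ f' → η X f p FB.∼ η X f' p'
      η-nat   : ∀ {X Y} (g : X → Y) (f : FA.FS X) (p : F.mem X f)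
                (q : F.mem Y (FA.FSmap g f)) →
                η Y (FA.FSmap g f) q FB.∼ FB.FSmap g (η X f p)

  record NatTransFull : Set₁ where
    field
      η'      : (X : Set) → FA.FS X → FB.FS X
      η'-resp : ∀ {X} {f f' : FA.FS X} → f FA.∼ f' → η' X f FB.∼ η' X f'
      η'-nat  : ∀ {X Y} (g : X → Y) (f : FA.FS X) →
                η' Y (FA.FSmap g f) FB.∼ FB.FSmap g (η' X f)

{-# OPTIONS --safe #-}
module Submission where

open import Defs
open import Level using (0ℓ)
open import Data.Product using (Σ; _,_)
open import Data.List using ([])
open import Data.Empty using (⊥-elim)
open import Algebra.Bundles using (CommutativeMonoid)
open import Axiom.ExcludedMiddle using (ExcludedMiddle)
open import Relation.Nullary using (Dec; yes; no)

-- Extend λ by zero outside F.  Membership in F is preserved by every F_A(g)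
-- and, by hypothesis, reflected by it, so f and F_A(g)(f) lie in F or outside
-- F together; in the first case naturality is that of λ, in the second both
-- sides are zero.  Excluded middle decides membership in F.

module _ {A B : CommutativeMonoid 0ℓ 0ℓ} where
  private
    module FA = FinSupp A
    module FB = FinSupp B

  ReflectedByMaps : FA.Subfunctor → Set₁
  ReflectedByMaps F = ∀ {X Y : Set} (g : X → Y) (f : FA.FS X) →
    FA.Subfunctor.mem F Y (FA.FSmap g f) → FA.Subfunctor.mem F X f

  module ZeroExtension {F : FA.Subfunctor} {G : FB.Subfunctor} (λ₀ : NatTrans A B F G) where
    open FA.Subfunctor F using (mem; mem-∼; mem-map)
    open NatTrans λ₀ using (η; η-resp; η-nat)

    extendByZero : ∀ X f → Dec (mem X f) → FB.FS X
    extendByZero X f (yes p) = η X f p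
    extendByZero X f (no _)  = []

    extendByZero-resp : ∀ {X} {f f' : FA.FS X} → f FA.∼ f' →
      (d : Dec (mem X f)) (d' : Dec (mem X f')) →
      extendByZero X f d FB.∼ extendByZero X f' d'
    extendByZero-resp f∼f' (yes p) (yes p') = η-resp p p' f∼f'
    extendByZero-resp f∼f' (yes p) (no ¬p') = ⊥-elim (¬p' (mem-∼ f∼f' p))
    extendByZero-resp f∼f' (no ¬p) (yes p') = ⊥-elim (¬p (mem-∼ (FA.∼-sym f∼f') p'))
    extendByZero-resp f∼f' (no _)  (no _)   = FB.∼-refl

    extendByZero-nat : ReflectedByMaps F → ∀ {X Y} (g : X → Y) (f : FA.FS X) →
      (d : Dec (mem Y (FA.FSmap g f))) (d' : Dec (mem X f)) →
      extendByZero Y (FA.FSmap g f) d FB.∼ FB.FSmap g (extendByZero X f d')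
    extendByZero-nat reflects g f (yes q) (yes p) = η-nat g f p q
    extendByZero-nat reflects g f (yes q) (no ¬p) = ⊥-elim (¬p (reflects g f q))
    extendByZero-nat reflects g f (no ¬q) (yes p) = ⊥-elim (¬q (mem-map g f p))
    extendByZero-nat reflects g f (no _)  (no _)  = FB.∼-refl

    extendByZero-agrees : ∀ X f (p : mem X f) (d : Dec (mem X f)) →
      extendByZero X f d FB.∼ η X f p
    extendByZero-agrees X f p (yes p') = η-resp p' p FA.∼-refl
    extendByZero-agrees X f p (no ¬p)  = ⊥-elim (¬p p)

    zeroExtension : (∀ X f → Dec (mem X f)) → ReflectedByMaps F → NatTransFull A B
    zeroExtension mem? reflects = record
      { η'      = λ X f → extendByZero X f (mem? X f)
      ; η'-resp = λ {X} {f} {f'} f∼f' → extendByZero-resp f∼f' (mem? X f) (mem? X f')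
      ; η'-nat  = λ {X} {Y} g f →
          extendByZero-nat reflects g f (mem? Y (FA.FSmap g f)) (mem? X f)
      }

lemma4p10 : ExcludedMiddle 0ℓ →
    (A B : CommutativeMonoid 0ℓ 0ℓ) →
    (F : FinSupp.Subfunctor A) (G : FinSupp.Subfunctor B) →
    (∀ {X Y : Set} (g : X → Y) (f : FinSupp.FS A X) →
       FinSupp.Subfunctor.mem F Y (FinSupp.FSmap A g f) → FinSupp.Subfunctor.mem F X f) →
    (λ₀ : NatTrans A B F G) →
    Σ (NatTransFull A B) λ λ' →
      ∀ (X : Set) (f : FinSupp.FS A X) (p : FinSupp.Subfunctor.mem F X f) →
        FinSupp._∼_ B (NatTransFull.η' λ' X f) (NatTrans.η λ₀ X f p)
lemma4p10 em A B F G reflects λ₀ =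
  zeroExtension mem? reflects , λ X f p → extendByZero-agrees X f p (mem? X f)
  where
    open ZeroExtension λ₀
    mem? : ∀ X f → Dec (FinSupp.Subfunctor.mem F X f)
    mem? X f = em
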